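{- Let $b$ be a positive integer. A lattice point $(r,s)\in\mathbb{N}\times\mathbb{N}$ is $(-b)$-visible from $(\infty,0)$ if and only if there does not exist a prime $p$ such that $p^b\mid s$.
   Context: $\mathbb{N}=\{1,2,3,\ldots\}$. For a positive integer $b$, a point $(r,s)\in\mathbb{N}\times\mathbb{N}$ is $(-b)$-visible (from the point at infinity $(\infty,0)$ on the positive $x$-axis) if it lies on the graph of $f(x)=nx^{ -b}$ for some $n\in\mathbb{Q}$ and there is no other point of $\mathbb{N}\times\mathbb{N}$ on the graph of $f$ lying between $(r,s)$ and $(\infty,0)$ (i.e. no $(r',s')\in\mathbb{N}\times\mathbb{N}$ with $s'=f(r')$ and $r'>r$). -}

module Defs where

open import Data.Nat as ℕ using (ℕ; NonZero; _<_; _^_)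
open import Data.Nat.Properties using (m^n≢0)
open import Data.Integer using (+_)
open import Data.Rational as ℚ using (ℚ)
open import Data.Product using (Σ; ∃-syntax; _×_)
open import Relation.Binary.PropositionalEquality using (_≡_)
open import Relation.Nullary using (¬_)

-- Points of ℕ × ℕ with ℕ = {1,2,3,...} are represented by natural numbers
-- carrying NonZero proofs.

invPow : (b x : ℕ) → .{{NonZero x}} → ℚ
invPow b x = (+ 1 ℚ./ (x ^ b)) {{m^n≢0 x b}}

OnGraph : (b : ℕ) (n : ℚ) (x y : ℕ) → .{{NonZero x}} → Set
OnGraph b n x y = (+ y ℚ./ 1) ≡ n ℚ.* invPow b x

Visible : (b r s : ℕ) → .{{NonZero r}} → Set
Visible b r s =
  ∃[ n ] (OnGraph b n r s ×
          ¬ (Σ ℕ λ r' → Σ ℕ λ s' → Σ (NonZero r') λ nz → NonZero s' ×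
               r < r' × OnGraph b n r' s' {{nz}}))

module Submission where

-- A point (x , y) lies on the curve y = n · x^{-b} exactly when n is the
-- natural number  y · x^b , the "coefficient" of the point.  So (r , s) is
-- (-b)-visible iff no point (r' , s') with r' > r has the same coefficient as
-- (r , s), and the theorem becomes a statement about ℕ:
--
--   * if s = q · p^b for a prime p, then (r · p , q) has the same coefficient
--     as (r , s) and lies further out, so (r , s) is hidden;
--   * conversely, if s' · r'^b = s · r^b with 0 < r < r', pick a prime p ∣ r'.
--     If p ∤ r then p^b ∣ s · r^b forces p^b ∣ s; if p ∣ r then p cancels
--     from r and r', and we descend (well-founded induction on r).

open import Defs
open import Data.Nat using (ℕ; NonZero; _^_)
open import Data.Nat.Divisibility using (_∣_)
open import Data.Nat.Primality using (Prime)
open import Data.Product using (∃-syntax; _×_)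
open import Relation.Nullary using (¬_)
open import Function.Bundles using (_⇔_)

open import Data.Nat as ℕ using (zero; suc; _<_; _*_)
open import Data.Nat.Properties as ℕP using (m^n≢0)
open import Data.Nat.Divisibility as ∣ using (divides; _∣?_)
open import Data.Nat.Induction using (<-wellFounded)
open import Data.Nat.Primality using (euclidsLemma; prime⇒nonZero; prime⇒nonTrivial)
open import Data.Nat.Primality.Factorisation using (factorise)
open import Data.Integer using (+_)
import Data.Integer.Properties as ℤP
open import Data.Rational as ℚ using (ℚ; 1ℚ; toℚᵘ; fromℚᵘ)
import Data.Rational.Properties as ℚP
open import Data.Rational.Unnormalised as ℚᵘ using (mkℚᵘ; *≡*)
import Data.Rational.Unnormalised.Properties as ℚᵘP
open import Data.Product using (_,_)
open import Data.Sum using (inj₁; inj₂)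
open import Data.Empty using (⊥-elim)
open import Data.List using (_∷_; [])
open import Data.List.Relation.Unary.All using (_∷_)
open import Induction.WellFounded using (Acc; acc)
open import Relation.Nullary using (yes; no)
open import Relation.Binary.PropositionalEquality
open import Function.Bundles using (mk⇔; Equivalence)

⟦_⟧ : ℕ → ℚ
⟦ y ⟧ = + y ℚ./ 1

-- Normalisation commutes with multiplication; lets us compute products of
-- fractions in the unnormalised rationals, where they are syntactic.
fromℚᵘ-homo-* : ∀ p q → fromℚᵘ (p ℚᵘ.* q) ≡ fromℚᵘ p ℚ.* fromℚᵘ q
fromℚᵘ-homo-* p q = ℚP.toℚᵘ-injective (begin
  toℚᵘ (fromℚᵘ (p ℚᵘ.* q))                    ≈⟨ ℚP.toℚᵘ-fromℚᵘ (p ℚᵘ.* q) ⟩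
  p ℚᵘ.* q                                    ≈⟨ ℚᵘP.*-cong (ℚP.toℚᵘ-fromℚᵘ p) (ℚP.toℚᵘ-fromℚᵘ q) ⟨
  toℚᵘ (fromℚᵘ p) ℚᵘ.* toℚᵘ (fromℚᵘ q)        ≈⟨ ℚP.toℚᵘ-homo-* (fromℚᵘ p) (fromℚᵘ q) ⟨
  toℚᵘ (fromℚᵘ p ℚ.* fromℚᵘ q)                ∎)
  where open ℚᵘP.≃-Reasoning

⟦⟧-homo-* : ∀ y m → ⟦ y * m ⟧ ≡ ⟦ y ⟧ ℚ.* ⟦ m ⟧
⟦⟧-homo-* y m = trans (cong (ℚ._/ 1) (ℤP.pos-* y m))
                      (fromℚᵘ-homo-* (mkℚᵘ (+ y) 0) (mkℚᵘ (+ m) 0))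

⟦⟧-inverse : ∀ m .{{_ : NonZero m}} → ⟦ m ⟧ ℚ.* (+ 1 ℚ./ m) ≡ 1ℚ
⟦⟧-inverse zero = ⊥-elim (ℕ.≢-nonZero⁻¹ 0 refl)
⟦⟧-inverse (suc k) = trans (sym (fromℚᵘ-homo-* (mkℚᵘ (+ suc k) 0) (mkℚᵘ (+ 1) k)))
                           (ℚP.fromℚᵘ-cong (ℚᵘP.*-inverseʳ (mkℚᵘ (+ suc k) 0)))

⟦⟧-injective : ∀ {a c} → ⟦ a ⟧ ≡ ⟦ c ⟧ → a ≡ c
⟦⟧-injective {a} {c} eq with ℚP.fromℚᵘ-injective {mkℚᵘ (+ a) 0} {mkℚᵘ (+ c) 0} eq
... | *≡* a·1≡c·1 =
  ℤP.+-injective (trans (sym (ℤP.*-identityʳ (+ a))) (trans a·1≡c·1 (ℤP.*-identityʳ (+ c))))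

scaled⇔ : ∀ y m n .{{_ : NonZero m}} → (⟦ y ⟧ ≡ n ℚ.* (+ 1 ℚ./ m)) ⇔ (n ≡ ⟦ y * m ⟧)
scaled⇔ y m n = mk⇔ solve check
  where
  open ≡-Reasoning
  1/m : ℚ
  1/m = + 1 ℚ./ m
  solve : ⟦ y ⟧ ≡ n ℚ.* 1/m → n ≡ ⟦ y * m ⟧
  solve on = begin
    n                          ≡⟨ ℚP.*-identityʳ n ⟨
    n ℚ.* 1ℚ                   ≡⟨ cong (n ℚ.*_) (trans (ℚP.*-comm 1/m ⟦ m ⟧) (⟦⟧-inverse m)) ⟨
    n ℚ.* (1/m ℚ.* ⟦ m ⟧)      ≡⟨ ℚP.*-assoc n 1/m ⟦ m ⟧ ⟨
    n ℚ.* 1/m ℚ.* ⟦ m ⟧        ≡⟨ cong (ℚ._* ⟦ m ⟧) on ⟨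
    ⟦ y ⟧ ℚ.* ⟦ m ⟧            ≡⟨ ⟦⟧-homo-* y m ⟨
    ⟦ y * m ⟧                  ∎
  check : n ≡ ⟦ y * m ⟧ → ⟦ y ⟧ ≡ n ℚ.* 1/m
  check refl = sym (begin
    ⟦ y * m ⟧ ℚ.* 1/m          ≡⟨ cong (ℚ._* 1/m) (⟦⟧-homo-* y m) ⟩
    ⟦ y ⟧ ℚ.* ⟦ m ⟧ ℚ.* 1/m    ≡⟨ ℚP.*-assoc ⟦ y ⟧ ⟦ m ⟧ 1/m ⟩
    ⟦ y ⟧ ℚ.* (⟦ m ⟧ ℚ.* 1/m)  ≡⟨ cong (⟦ y ⟧ ℚ.*_) (⟦⟧-inverse m) ⟩
    ⟦ y ⟧ ℚ.* 1ℚ               ≡⟨ ℚP.*-identityʳ ⟦ y ⟧ ⟩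
    ⟦ y ⟧                      ∎)

coefficient : (b x y : ℕ) → ℕ
coefficient b x y = y * x ^ b

onGraph⇔ : ∀ b n x y .{{_ : NonZero x}} → OnGraph b n x y ⇔ (n ≡ ⟦ coefficient b x y ⟧)
onGraph⇔ b n x y = scaled⇔ y (x ^ b) n {{m^n≢0 x b}}

^-distribʳ-* : ∀ a c k → (a * c) ^ k ≡ a ^ k * c ^ k
^-distribʳ-* a c zero = refl
^-distribʳ-* a c (suc k) = begin
  a * c * (a * c) ^ k        ≡⟨ cong (a * c *_) (^-distribʳ-* a c k) ⟩
  a * c * (a ^ k * c ^ k)    ≡⟨ ℕP.[m*n]*[o*p]≡[m*o]*[n*p] a c (a ^ k) (c ^ k) ⟩
  a * a ^ k * (c * c ^ k)    ∎
  where open ≡-Reasoning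

coefficient-*-abscissa : ∀ b x c y → coefficient b (x * c) y ≡ coefficient b x y * c ^ b
coefficient-*-abscissa b x c y = begin
  y * (x * c) ^ b            ≡⟨ cong (y *_) (^-distribʳ-* x c b) ⟩
  y * (x ^ b * c ^ b)        ≡⟨ ℕP.*-assoc y (x ^ b) (c ^ b) ⟨
  y * x ^ b * c ^ b          ∎
  where open ≡-Reasoning

coefficient-shift : ∀ b x c y → coefficient b (x * c) y ≡ coefficient b x (y * c ^ b)
coefficient-shift b x c y = begin
  coefficient b (x * c) y    ≡⟨ coefficient-*-abscissa b x c y ⟩
  y * x ^ b * c ^ b          ≡⟨ ℕP.*-assoc y (x ^ b) (c ^ b) ⟩
  y * (x ^ b * c ^ b)        ≡⟨ cong (y *_) (ℕP.*-comm (x ^ b) (c ^ b)) ⟩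
  y * (c ^ b * x ^ b)        ≡⟨ ℕP.*-assoc y (c ^ b) (x ^ b) ⟨
  y * c ^ b * x ^ b          ∎
  where open ≡-Reasoning

prime>1 : ∀ {p} → Prime p → 1 < p
prime>1 {p} p-prime = ℕ.nonTrivial⇒n>1 p {{prime⇒nonTrivial p-prime}}

prime-divisor : ∀ n → 1 < n → ∃[ p ] (Prime p × p ∣ n)
prime-divisor n@(suc _) 1<n with factorise n
... | record { factors = [] ; isFactorisation = n≡1 } = ⊥-elim (ℕP.<⇒≢ 1<n (sym n≡1))
... | record { factors = p ∷ _ ; isFactorisation = n≡p·rest ; factorsPrime = p-prime ∷ _ } =
  p , p-prime , subst (p ∣_) (sym n≡p·rest) (∣.m∣m*n _)

∣-^ : ∀ {d n} k → d ∣ n → d ^ k ∣ n ^ k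
∣-^ zero    d∣n = ∣.∣-refl
∣-^ (suc k) d∣n = ∣.*-pres-∣ d∣n (∣-^ k d∣n)

prime∤^ : ∀ {p c} → Prime p → ¬ p ∣ c → ∀ j → ¬ p ∣ c ^ j
prime∤^ p-prime p∤c zero p∣1 = ℕP.<⇒≢ (prime>1 p-prime) (sym (∣.∣1⇒≡1 p∣1))
prime∤^ {c = c} p-prime p∤c (suc j) p∣c·cʲ with euclidsLemma c (c ^ j) p-prime p∣c·cʲ
... | inj₁ p∣c  = p∤c p∣c
... | inj₂ p∣cʲ = prime∤^ p-prime p∤c j p∣cʲ

prime-power-cancel : ∀ {p c} → Prime p → ¬ p ∣ c → ∀ k x → p ^ k ∣ x * c → p ^ k ∣ x
prime-power-cancel p-prime p∤c zero x _ = ∣.1∣ x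
prime-power-cancel {p} {c} p-prime p∤c (suc k) x pᵏ⁺¹∣xc
  with euclidsLemma x c p-prime (∣.∣-trans (∣.m∣m*n (p ^ k)) pᵏ⁺¹∣xc)
... | inj₂ p∣c = ⊥-elim (p∤c p∣c)
... | inj₁ (divides x′ refl) =
  subst (p * p ^ k ∣_) (ℕP.*-comm p x′) (∣.*-monoʳ-∣ p (prime-power-cancel p-prime p∤c k x′ pᵏ∣x′c))
  where
  instance
    p≢0 : NonZero p
    p≢0 = prime⇒nonZero p-prime
  pᵏ∣x′c : p ^ k ∣ x′ * c
  pᵏ∣x′c = ∣.*-cancelˡ-∣ p (subst (p * p ^ k ∣_)
    (trans (cong (_* c) (ℕP.*-comm x′ p)) (ℕP.*-assoc p x′ c)) pᵏ⁺¹∣xc)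

-- The recursion removes a common
-- prime factor from both abscissae, so it is well-founded on r.
shared-coefficient⇒prime-power : ∀ b {r r′ s s′} → Acc _<_ r → .{{_ : NonZero r}} →
  r < r′ → coefficient b r′ s′ ≡ coefficient b r s → ∃[ p ] (Prime p × p ^ b ∣ s)
shared-coefficient⇒prime-power b {r} {r′} {s} {s′} (acc smaller) r<r′ same
  with prime-divisor r′ (ℕP.≤-<-trans (ℕ.>-nonZero⁻¹ r) r<r′)
... | p , p-prime , p∣r′ with p ∣? r
... | no p∤r = p , p-prime , prime-power-cancel p-prime (prime∤^ p-prime p∤r b) b s pᵇ∣sr
  where
  pᵇ∣sr : p ^ b ∣ s * r ^ b
  pᵇ∣sr = subst (p ^ b ∣_) same (∣.∣n⇒∣m*n s′ (∣-^ b p∣r′))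
... | yes (divides r₀ refl) with p∣r′
... | divides r₀′ refl =
  shared-coefficient⇒prime-power b {s = s} {s′} (smaller r₀<r) {{r₀≢0}}
    (ℕP.*-cancelʳ-< p r₀ r₀′ r<r′) same₀
  where
  instance
    pᵇ≢0 : NonZero (p ^ b)
    pᵇ≢0 = m^n≢0 p b {{prime⇒nonZero p-prime}}
  r₀≢0 : NonZero r₀
  r₀≢0 = ℕP.m*n≢0⇒m≢0 r₀
  r₀<r : r₀ < r₀ * p
  r₀<r = ℕP.m<m*n r₀ p {{r₀≢0}} (prime>1 p-prime)
  same₀ : coefficient b r₀′ s′ ≡ coefficient b r₀ s
  same₀ = ℕP.*-cancelʳ-≡ _ _ (p ^ b) (begin
    coefficient b r₀′ s′ * p ^ b   ≡⟨ coefficient-*-abscissa b r₀′ p s′ ⟨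
    coefficient b (r₀′ * p) s′     ≡⟨ same ⟩
    coefficient b (r₀ * p) s       ≡⟨ coefficient-*-abscissa b r₀ p s ⟩
    coefficient b r₀ s * p ^ b     ∎)
    where open ≡-Reasoning

proposition3 : (b : ℕ) → .{{NonZero b}} → (r s : ℕ) → .{{_ : NonZero r}} → .{{NonZero s}} →
    Visible b r s ⇔ (¬ (∃[ p ] (Prime p × p ^ b ∣ s)))
proposition3 b r s = mk⇔ hidden-if-prime-power visible-if-free
  where
  -- s = q · p^b hides (r , s) behind (r · p , q), which has the same coefficient.
  hidden-if-prime-power : Visible b r s → ¬ (∃[ p ] (Prime p × p ^ b ∣ s))
  hidden-if-prime-power (n , on , nothing-further) (p , p-prime , divides q refl) =
    nothing-further (r * p , q , r·p≢0 , q≢0 , ℕP.m<m*n r p (prime>1 p-prime) , on′)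
    where
    instance
      p≢0 : NonZero p
      p≢0 = prime⇒nonZero p-prime
    r·p≢0 : NonZero (r * p)
    r·p≢0 = ℕP.m*n≢0 r p
    q≢0 : NonZero q
    q≢0 = ℕP.m*n≢0⇒m≢0 q
    on′ : OnGraph b n (r * p) q {{r·p≢0}}
    on′ = Equivalence.from (onGraph⇔ b n (r * p) q {{r·p≢0}})
      (trans (Equivalence.to (onGraph⇔ b n r s) on) (cong ⟦_⟧ (sym (coefficient-shift b r p q))))
  visible-if-free : ¬ (∃[ p ] (Prime p × p ^ b ∣ s)) → Visible b r s
  visible-if-free free = ⟦ coefficient b r s ⟧ , Equivalence.from (onGraph⇔ b _ r s) refl ,
    λ (r′ , s′ , r′≢0 , _ , r<r′ , on′) → free (shared-coefficient⇒prime-power b {s = s} {s′}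
      (<-wellFounded r) r<r′
      (⟦⟧-injective (sym (Equivalence.to (onGraph⇔ b _ r′ s′ {{r′≢0}}) on′))))
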